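{- Let $G$ be a finite directed graph and $R\subseteq V(G)$ nonempty. If $\mathrm{DT}_R(G)$ has more than one maximal face, then there is an edge $(x\rightarrow y)\in E(G)$ which is nice in $\mathrm{DT}_R(G)$.
   Context: A directed forest in a directed graph $G$ is a set $F$ of edges of $G$ such that at most one edge of $F$ is directed to each vertex and $F$ contains no directed cycle. The roots of $F$ are the vertices of $G$ with no edge of $F$ directed to them. $\mathrm{DT}(G)$ is the simplicial complex with vertex set $E(G)$ whose faces are the edge sets of directed forests of $G$. For $R\subseteq V(G)$, $\mathrm{DT}_R(G)\subseteq\mathrm{DT}(G)$ is the subcomplex generated by the directed forests whose set of roots is exactly $R$. For a subcomplex $\Delta$ of $\mathrm{DT}(G)$, an edge $(x\rightarrow y)$ of $G$ is nice in $\Delta$ if (i) there is an edge $(z\rightarrow y)$ which is a vertex of $\Delta$ with $z\neq x$, and (ii) for every forest $F\in\Delta$ containing no edge directed to $y$, $F\cup\{(x\rightarrow y)\}$ is a directed forest and belongs to $\Delta$. -}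

module Defs where

open import Data.Nat using (ℕ)
open import Data.Fin using (Fin; _≟_)
open import Data.Bool using (Bool; true; false; _∧_; _∨_)
open import Data.Product using (Σ; ∃; _×_; _,_)
open import Relation.Nullary using (¬_; does)
open import Relation.Binary.PropositionalEquality using (_≡_; _≢_)

-- A finite directed graph on vertex set Fin n, given by its edge relation
-- (E x y ≡ true  iff  (x → y) is an edge of G).
Digraph : ℕ → Set
Digraph n = Fin n → Fin n → Bool

EdgeSet : ℕ → Set
EdgeSet n = Fin n → Fin n → Bool

VSet : ℕ → Set
VSet n = Fin n → Bool

module _ {n : ℕ} where

  _⊆_ : EdgeSet n → EdgeSet n → Set
  A ⊆ B = ∀ x y → A x y ≡ true → B x y ≡ true

  ⟦_⇒_⟧ : Fin n → Fin n → EdgeSet n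
  ⟦ x ⇒ y ⟧ u v = does (u ≟ x) ∧ does (v ≟ y)

  _∪_ : EdgeSet n → EdgeSet n → EdgeSet n
  (A ∪ B) u v = A u v ∨ B u v

  -- directed path of length ≥ 1 using edges of F
  data Path (F : EdgeSet n) : Fin n → Fin n → Set where
    step : ∀ {x y} → F x y ≡ true → Path F x y
    cons : ∀ {x z y} → F x z ≡ true → Path F z y → Path F x y

  record DirectedForest (G : Digraph n) (F : EdgeSet n) : Set where
    field
      inG       : F ⊆ G
      indeg≤1   : ∀ x x' y → F x y ≡ true → F x' y ≡ true → x ≡ x'
      noCycle   : ∀ x → ¬ Path F x x

  IsRoot : EdgeSet n → Fin n → Set
  IsRoot F v = ∀ u → F u v ≡ false

  RootsExactly : EdgeSet n → VSet n → Set
  RootsExactly F R = ∀ v → (R v ≡ true → IsRoot F v) × (IsRoot F v → R v ≡ true)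

  FaceDT : Digraph n → VSet n → EdgeSet n → Set
  FaceDT G R σ = Σ (EdgeSet n) λ F → DirectedForest G F × RootsExactly F R × σ ⊆ F

  MaximalFace : Digraph n → VSet n → EdgeSet n → Set
  MaximalFace G R σ = FaceDT G R σ × (∀ τ → FaceDT G R τ → σ ⊆ τ → τ ⊆ σ)

  MoreThanOneMaximal : Digraph n → VSet n → Set
  MoreThanOneMaximal G R =
    Σ (EdgeSet n) λ σ → Σ (EdgeSet n) λ τ →
      MaximalFace G R σ × MaximalFace G R τ × ∃ λ u → ∃ λ v → σ u v ≢ τ u v

  record NiceDT (G : Digraph n) (R : VSet n) (x y : Fin n) : Set where
    field
      other : Σ (Fin n) λ z → z ≢ x × FaceDT G R ⟦ z ⇒ y ⟧
      ext   : ∀ F → FaceDT G R F → IsRoot F y →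
                DirectedForest G (F ∪ ⟦ x ⇒ y ⟧) × FaceDT G R (F ∪ ⟦ x ⇒ y ⟧)

-- An R-forest of G is determined by its parent map (on the vertices outside R), and acyclicity
-- of a parent map is decidable: every vertex must reach R within n steps.  Enumerating parent
-- maps as vectors therefore makes statements quantified over all R-forests decidable.
--
-- Call (x → y) certified if y ∉ R, some R-forest gives y a parent z ≠ x, and no R-forest has a
-- path from y to x.  Then replacing the edge into y by (x → y) never closes a cycle, so a
-- certified edge is nice.  If no edge is certified, any two R-forests F₁, F₂ have the same
-- parents, by induction on the distance to R in F₁: if v ∉ R has the F₂-parent z ≠ x, where
-- x is its F₁-parent, then some R-forest F has a path v ⇝ x; the vertices on it are closer to
-- R than v, so their F-parents are their F₁-parents, and v ⇝ x → v is a cycle in F₁.  Hence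
-- DT_R(G) has only one maximal face.
module Submission where

open import Defs
open import Data.Nat using (ℕ)
open import Data.Fin using (Fin)
open import Data.Bool using (true)
open import Data.Product using (Σ; ∃; _×_)
open import Relation.Binary.PropositionalEquality using (_≡_)

open import Data.Nat using (zero; suc; _<_; _≤_; s≤s)
open import Data.Nat.Properties using (n<1+n; m<1+n⇒m<n∨m≡n; m<1+n⇒m≤n; m<n⇒m<1+n; <⇒≤; <-≤-trans)
open import Data.Fin using (toℕ; _≟_)
open import Data.Fin.Properties using (any?; all?; pigeonhole; toℕ<n)
open import Data.Bool using (Bool; false; not; _∧_; _∨_; if_then_else_)
import Data.Bool.Properties as Bool
open import Data.Vec using (Vec; []; _∷_; lookup; tabulate)
open import Data.Vec.Properties using (lookup∘tabulate)
open import Data.Product using (_,_; proj₁; proj₂)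
open import Data.Sum using (_⊎_; inj₁; inj₂; [_,_])
open import Data.Empty using (⊥-elim)
open import Function using (_∘_; id)
open import Relation.Nullary using (¬_; Dec; yes; no; does; contradiction)
open import Relation.Nullary.Decidable using (map′; _×-dec_; _→-dec_; ¬?; dec-true)
open import Relation.Binary.PropositionalEquality
  using (refl; sym; trans; cong; subst; _≢_; module ≡-Reasoning)

∃-Vec? : ∀ {m} k {P : Vec (Fin m) k → Set} → (∀ c → Dec (P c)) → Dec (∃ P)
∃-Vec? zero P? = map′ ([] ,_) (λ { ([] , p) → p }) (P? [])
∃-Vec? (suc k) P? =
  map′ (λ { (a , c , p) → a ∷ c , p }) (λ { (a ∷ c , p) → a , c , p })
       (any? λ a → ∃-Vec? k (P? ∘ (a ∷_)))

module _ {n : ℕ} where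

  _≐_ : EdgeSet n → EdgeSet n → Set
  A ≐ B = ∀ u v → A u v ≡ B u v

  ⊆-refl : {A : EdgeSet n} → A ⊆ A
  ⊆-refl _ _ e = e

  ⊆-trans : {A B C : EdgeSet n} → A ⊆ B → B ⊆ C → A ⊆ C
  ⊆-trans A⊆B B⊆C u v = B⊆C u v ∘ A⊆B u v

  ⊆-antisym : {A B : EdgeSet n} → A ⊆ B → B ⊆ A → A ≐ B
  ⊆-antisym {A} {B} A⊆B B⊆A u v with A u v in a | B u v in b
  ... | true  | true  = refl
  ... | false | false = refl
  ... | true  | false = contradiction (A⊆B u v a) (Bool.not-¬ b)
  ... | false | true  = contradiction (B⊆A u v b) (Bool.not-¬ a)

  ∪-⊆ : {A B C : EdgeSet n} → A ⊆ C → B ⊆ C → (A ∪ B) ⊆ C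
  ∪-⊆ {A} A⊆C B⊆C u v e with A u v in a
  ... | true  = A⊆C u v a
  ... | false = B⊆C u v e

  ⟦⇒⟧-⊆ : {A : EdgeSet n} {x y : Fin n} → A x y ≡ true → ⟦ x ⇒ y ⟧ ⊆ A
  ⟦⇒⟧-⊆ {x = x} {y} a u v e with u ≟ x | v ≟ y
  ... | yes refl | yes refl = a

  Path-mono : {A B : EdgeSet n} → A ⊆ B → ∀ {a b} → Path A a b → Path B a b
  Path-mono A⊆B (step e)   = step (A⊆B _ _ e)
  Path-mono A⊆B (cons e p) = cons (A⊆B _ _ e) (Path-mono A⊆B p)

  Path-trans : {A : EdgeSet n} → ∀ {a m b} → Path A a m → Path A m b → Path A a b
  Path-trans (step e)   q = cons e q
  Path-trans (cons e p) q = cons e (Path-trans p q)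

  Walk : EdgeSet n → Fin n → Fin n → Set
  Walk A a b = a ≡ b ⊎ Path A a b

  Walk-trans : {A : EdgeSet n} → ∀ {a m b} → Walk A a m → Walk A m b → Walk A a b
  Walk-trans (inj₁ refl) w           = w
  Walk-trans (inj₂ p)    (inj₁ refl) = inj₂ p
  Walk-trans (inj₂ p)    (inj₂ q)    = inj₂ (Path-trans p q)

  DirectedForest-⊆ : {G : Digraph n} {A B : EdgeSet n} → A ⊆ B → DirectedForest G B → DirectedForest G A
  DirectedForest-⊆ A⊆B forest = record
    { inG     = λ x y → inG x y ∘ A⊆B x y
    ; indeg≤1 = λ x x' y e e' → indeg≤1 x x' y (A⊆B _ _ e) (A⊆B _ _ e')
    ; noCycle = λ x → noCycle x ∘ Path-mono A⊆B
    }
    where open DirectedForest forest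

  redirect : EdgeSet n → Fin n → Fin n → EdgeSet n
  redirect F x y u v = if does (v ≟ y) then does (u ≟ x) else F u v

  module _ {F : EdgeSet n} {x y : Fin n} where

    redirect-new : redirect F x y x y ≡ true
    redirect-new rewrite dec-true (y ≟ y) refl | dec-true (x ≟ x) refl = refl

    redirect-⊇ : {F₀ : EdgeSet n} → F₀ ⊆ F → IsRoot F₀ y → F₀ ⊆ redirect F x y
    redirect-⊇ F₀⊆F y-root u v e with v ≟ y
    ... | yes refl = contradiction e (Bool.not-¬ (y-root u))
    ... | no _     = F₀⊆F u v e

    redirect-path : ∀ {a b} → Path (redirect F x y) a b → Path F a b ⊎ (Walk F a x × Walk F y b)
    redirect-path {a} {b} (step e) with b ≟ y | a ≟ x
    ... | yes refl | yes refl = inj₂ (inj₁ refl , inj₁ refl)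
    ... | no _     | _        = inj₁ (step e)
    redirect-path {a} (cons {z = m} e p) with m ≟ y | a ≟ x | redirect-path p
    ... | yes refl | yes refl | inj₁ q       = inj₂ (inj₁ refl , inj₂ q)
    ... | yes refl | yes refl | inj₂ (_ , w) = inj₂ (inj₁ refl , w)
    ... | no _     | _        | inj₁ q       = inj₁ (cons e q)
    ... | no _     | _        | inj₂ (w , w') = inj₂ (Walk-trans (inj₂ (step e)) w , w')

    redirect-forest : {G : Digraph n} → DirectedForest G F → G x y ≡ true → x ≢ y → ¬ Path F y x →
                      DirectedForest G (redirect F x y)
    redirect-forest {G} forest gxy x≢y y↛x =
      record { inG = inG″ ; indeg≤1 = indeg≤1″ ; noCycle = noCycle″ }
      where
        open DirectedForest forest

        inG″ : redirect F x y ⊆ G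
        inG″ u v e with v ≟ y | u ≟ x
        ... | yes refl | yes refl = gxy
        ... | no _     | _        = inG u v e

        indeg≤1″ : ∀ u u' v → redirect F x y u v ≡ true → redirect F x y u' v ≡ true → u ≡ u'
        indeg≤1″ u u' v e e' with v ≟ y | u ≟ x | u' ≟ x
        ... | yes _ | yes refl | yes refl = refl
        ... | no _  | _        | _        = indeg≤1 u u' v e e'

        noCycle″ : ∀ a → ¬ Path (redirect F x y) a a
        noCycle″ a cycle with redirect-path cycle
        ... | inj₁ q = noCycle a q
        ... | inj₂ (a⇝x , y⇝a) = [ x≢y ∘ sym , y↛x ] (Walk-trans y⇝a a⇝x)

    redirect-roots : {R : VSet n} → RootsExactly F R → R y ≡ false → RootsExactly (redirect F x y) R
    redirect-roots {R} roots ry v = root⇒ , ⇒root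
      where
        root⇒ : R v ≡ true → IsRoot (redirect F x y) v
        root⇒ rv u with v ≟ y
        ... | yes refl = contradiction rv (Bool.not-¬ ry)
        ... | no _     = proj₁ (roots v) rv u

        ⇒root : IsRoot (redirect F x y) v → R v ≡ true
        ⇒root v-root with v ≟ y
        ... | yes refl = contradiction (dec-true (x ≟ x) refl) (Bool.not-¬ (v-root x))
        ... | no _     = proj₂ (roots v) v-root

  forestOf : VSet n → (Fin n → Fin n) → EdgeSet n
  forestOf R p u v = not (R v) ∧ does (u ≟ p v)

  forestOf-cong : {R : VSet n} {p q : Fin n → Fin n} → (∀ v → R v ≡ false → q v ≡ p v) →
                  forestOf R p ≐ forestOf R q
  forestOf-cong {R} q≡p u v with R v in rv
  ... | true  = refl
  ... | false = cong (does ∘ (u ≟_)) (sym (q≡p v rv))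

module ForestOf {n : ℕ} (R : VSet n) (p : Fin n → Fin n) where

  forestOf⁺ : ∀ {u v} → R v ≡ false → u ≡ p v → forestOf R p u v ≡ true
  forestOf⁺ {v = v} rv refl rewrite rv | dec-true (p v ≟ p v) refl = refl

  forestOf⁻ : ∀ {u v} → forestOf R p u v ≡ true → R v ≡ false × u ≡ p v
  forestOf⁻ {u} {v} e with R v | u ≟ p v
  ... | false | yes u≡pv = refl , u≡pv

  forestOf-roots : RootsExactly (forestOf R p) R
  forestOf-roots v = root⇒ , ⇒root
    where
      root⇒ : R v ≡ true → IsRoot (forestOf R p) v
      root⇒ rv u rewrite rv = refl

      ⇒root : IsRoot (forestOf R p) v → R v ≡ true
      ⇒root v-root = Bool.¬-not λ rv → contradiction (forestOf⁺ rv refl) (Bool.not-¬ (v-root (p v)))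

  Path-target-∉ : ∀ {a b} → Path (forestOf R p) a b → R b ≡ false
  Path-target-∉ {a} (step e) = proj₁ (forestOf⁻ {a} e)
  Path-target-∉ (cons _ q)   = Path-target-∉ q

  Path-last : ∀ {a b} → Path (forestOf R p) a b → a ≡ p b ⊎ Path (forestOf R p) a (p b)
  Path-last (step e) = inj₁ (proj₂ (forestOf⁻ e))
  Path-last (cons e q) with Path-last q
  ... | inj₁ refl = inj₂ (step e)
  ... | inj₂ q′   = inj₂ (cons e q′)

  reachesRoot : ℕ → Fin n → Bool
  reachesRoot zero    v = R v
  reachesRoot (suc k) v = R v ∨ reachesRoot k (p v)

  reachesRoot-suc : ∀ k {v} → reachesRoot k v ≡ true → reachesRoot (suc k) v ≡ true
  reachesRoot-suc zero    {v} reach rewrite reach = refl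
  reachesRoot-suc (suc k) {v} reach with R v
  ... | true  = refl
  ... | false = reachesRoot-suc k reach

  reachesRoot-parent : ∀ k {v} → reachesRoot (suc k) v ≡ true → R v ≡ false → reachesRoot k (p v) ≡ true
  reachesRoot-parent k {v} reach rv rewrite rv = reach

  reachesRoot-edge : ∀ k {a b} → forestOf R p a b ≡ true → reachesRoot k b ≡ true → reachesRoot k a ≡ true
  reachesRoot-edge zero    {a} e reach = contradiction reach (Bool.not-¬ (proj₁ (forestOf⁻ {a} e)))
  reachesRoot-edge (suc k) {a} {b} e reach with forestOf⁻ {a} {b} e
  ... | rb , refl = reachesRoot-suc k (reachesRoot-parent k reach rb)

  reachesRoot-path : ∀ k {a b} → Path (forestOf R p) a b → reachesRoot k b ≡ true → reachesRoot k a ≡ true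
  reachesRoot-path k (step e)   = reachesRoot-edge k e
  reachesRoot-path k (cons e q) = reachesRoot-edge k e ∘ reachesRoot-path k q

  reachesRoot⇒acyclic : ∀ k {v} → reachesRoot k v ≡ true → ¬ Path (forestOf R p) v v
  reachesRoot⇒acyclic zero    reach cycle = contradiction reach (Bool.not-¬ (Path-target-∉ cycle))
  reachesRoot⇒acyclic (suc k) {v} reach cycle =
    reachesRoot⇒acyclic k (reachesRoot-parent k reach rv) parent-cycle
    where
      rv = Path-target-∉ cycle

      parent-cycle : Path (forestOf R p) (p v) (p v)
      parent-cycle = [ (λ v≡pv → subst (λ w → Path _ w w) v≡pv cycle) , cons (forestOf⁺ rv refl) ]
                     (Path-last cycle)

  path? : ∀ k a b → reachesRoot k b ≡ true → Dec (Path (forestOf R p) a b)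
  path? zero a b root = no λ q → contradiction root (Bool.not-¬ (Path-target-∉ q))
  path? (suc k) a b reach with R b in rb
  ... | true  = no λ q → contradiction rb (Bool.not-¬ (Path-target-∉ q))
  ... | false with a ≟ p b
  ...   | yes a≡pb = yes (step (forestOf⁺ rb a≡pb))
  ...   | no  a≢pb = map′ (λ q → Path-trans q (step (forestOf⁺ rb refl)))
                          (λ q → [ ⊥-elim ∘ a≢pb , id ] (Path-last q))
                          (path? k a (p b) reach)

  ancestor : ℕ → Fin n → Fin n
  ancestor zero    v = v
  ancestor (suc j) v = p (ancestor j v)

  ancestor-suc : ∀ j v → ancestor (suc j) v ≡ ancestor j (p v)
  ancestor-suc zero    v = refl
  ancestor-suc (suc j) v = cong p (ancestor-suc j v)

  ancestor-∉ : ∀ k v → reachesRoot k v ≡ false → ∀ j → j ≤ k → R (ancestor j v) ≡ false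
  ancestor-∉ zero    v unreached zero    _         = unreached
  ancestor-∉ (suc k) v unreached zero    _         = Bool.∨-conicalˡ (R v) _ unreached
  ancestor-∉ (suc k) v unreached (suc j) (s≤s j≤k) rewrite ancestor-suc j v =
    ancestor-∉ k (p v) (Bool.∨-conicalʳ (R v) _ unreached) j j≤k

  ancestor-path : ∀ {v} i j → (∀ t → t < j → R (ancestor t v) ≡ false) → i < j →
                  Path (forestOf R p) (ancestor j v) (ancestor i v)
  ancestor-path i (suc j) below i<1+j with m<1+n⇒m<n∨m≡n i<1+j
  ... | inj₂ refl = step (forestOf⁺ (below j (n<1+n j)) refl)
  ... | inj₁ i<j  = cons (forestOf⁺ (below j (n<1+n j)) refl)
                         (ancestor-path i j (λ t → below t ∘ m<n⇒m<1+n) i<j)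

  acyclic⇒reachesRoot : (∀ v → ¬ Path (forestOf R p) v v) → ∀ v → reachesRoot n v ≡ true
  acyclic⇒reachesRoot acyclic v with reachesRoot n v in reach
  ... | true  = refl
  ... | false with pigeonhole (n<1+n n) (λ t → ancestor (toℕ t) v)
  ...   | i , j , i<j , same =
    ⊥-elim (acyclic _ (subst (Path _ (ancestor (toℕ j) v)) same
                             (ancestor-path (toℕ i) (toℕ j) below i<j)))
    where
      below : ∀ t → t < toℕ j → R (ancestor t v) ≡ false
      below t t<j = ancestor-∉ n v reach t (<⇒≤ (<-≤-trans t<j (m<1+n⇒m≤n (toℕ<n j))))

module _ {n : ℕ} (G : Digraph n) (R : VSet n) where

  IsParentMap : (Fin n → Fin n) → Set
  IsParentMap p = ∀ v → (R v ≡ false → G (p v) v ≡ true) × ForestOf.reachesRoot R p n v ≡ true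

  isParentMap? : ∀ p → Dec (IsParentMap p)
  isParentMap? p = all? λ v → ((R v Bool.≟ false) →-dec (G (p v) v Bool.≟ true))
                              ×-dec (ForestOf.reachesRoot R p n v Bool.≟ true)

  module _ {p : Fin n → Fin n} (isParentMap : IsParentMap p) where
    open ForestOf R p

    parentMap-acyclic : ∀ {v} → ¬ Path (forestOf R p) v v
    parentMap-acyclic {v} = reachesRoot⇒acyclic n (proj₂ (isParentMap v))

    parentMap-forest : DirectedForest G (forestOf R p)
    parentMap-forest = record
      { inG     = λ u v e → let rv , u≡pv = forestOf⁻ {u} e in
                    subst (λ w → G w v ≡ true) (sym u≡pv) (proj₁ (isParentMap v) rv)
      ; indeg≤1 = λ u u' v e e' → trans (proj₂ (forestOf⁻ {u} e)) (sym (proj₂ (forestOf⁻ {u'} e')))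
      ; noCycle = λ v → parentMap-acyclic
      }

    parentMap-face : FaceDT G R (forestOf R p)
    parentMap-face = forestOf R p , parentMap-forest , forestOf-roots , ⊆-refl

  ∃ParentMap : ((Fin n → Fin n) → Set) → Set
  ∃ParentMap P = ∃ λ (c : Vec (Fin n) n) → IsParentMap (lookup c) × P (lookup c)

  ∃ParentMap? : {P : (Fin n → Fin n) → Set} → (∀ p → IsParentMap p → Dec (P p)) → Dec (∃ParentMap P)
  ∃ParentMap? P? = ∃-Vec? n λ c → decide (isParentMap? (lookup c))
    where
      decide : ∀ {p} → Dec (IsParentMap p) → Dec (IsParentMap p × _)
      decide (yes isParentMap) = map′ (isParentMap ,_) proj₂ (P? _ isParentMap)
      decide (no ¬isParentMap) = no (¬isParentMap ∘ proj₁)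

  encode : ∀ {F} → DirectedForest G F → RootsExactly F R → ∃ParentMap (λ p → F ⊆ forestOf R p)
  encode {F} forest roots = c , isParentMap , F⊆
    where
      open DirectedForest forest

      parent : Fin n → Fin n
      parent v with any? (λ u → F u v Bool.≟ true)
      ... | yes (u , _) = u
      ... | no _        = v

      c : Vec (Fin n) n
      c = tabulate parent

      open ForestOf R (lookup c)

      parent-edge : ∀ v → R v ≡ false → F (lookup c v) v ≡ true
      parent-edge v rv rewrite lookup∘tabulate parent v with any? (λ u → F u v Bool.≟ true)
      ... | yes (_ , e) = e
      ... | no  none    = contradiction (proj₂ (roots v) λ u → Bool.¬-not (none ∘ (u ,_))) (Bool.not-¬ rv)

      F⊆ : F ⊆ forestOf R (lookup c)
      F⊆ u v e = forestOf⁺ rv (indeg≤1 u _ v e (parent-edge v rv))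
        where rv = Bool.¬-not λ rv → contradiction e (Bool.not-¬ (proj₁ (roots v) rv u))

      ⊆F : forestOf R (lookup c) ⊆ F
      ⊆F u v e = let rv , u≡pv = forestOf⁻ {u} e in
                 subst (λ w → F w v ≡ true) (sym u≡pv) (parent-edge v rv)

      isParentMap : IsParentMap (lookup c)
      isParentMap v = (inG _ v ∘ parent-edge v) , acyclic⇒reachesRoot (λ w → noCycle w ∘ Path-mono ⊆F) v

  maximalFace-encode : ∀ {σ} → MaximalFace G R σ → ∃ParentMap (λ p → σ ≐ forestOf R p)
  maximalFace-encode ((F , forest , roots , σ⊆F) , maximal) with encode forest roots
  ... | c , isParentMap , F⊆ = c , isParentMap , ⊆-antisym σ⊆ (maximal _ (parentMap-face isParentMap) σ⊆)
    where σ⊆ = ⊆-trans σ⊆F F⊆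

  Reachable : Fin n → Fin n → Set
  Reachable a b = ∃ParentMap (λ p → Path (forestOf R p) a b)

  reachable? : ∀ a b → Dec (Reachable a b)
  reachable? a b = ∃ParentMap? λ p isParentMap → ForestOf.path? R p n a b (proj₂ (isParentMap b))

  NiceCertificate : Fin n → Fin n → Set
  NiceCertificate x y = G x y ≡ true × R y ≡ false × x ≢ y
                      × (∃ λ z → z ≢ x × ∃ParentMap (λ p → p y ≡ z)) × ¬ Reachable y x

  niceCertificate? : ∀ x y → Dec (NiceCertificate x y)
  niceCertificate? x y = (G x y Bool.≟ true) ×-dec (R y Bool.≟ false) ×-dec ¬? (x ≟ y)
    ×-dec any? (λ z → ¬? (z ≟ x) ×-dec ∃ParentMap? (λ p _ → p y ≟ z)) ×-dec ¬? (reachable? y x)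

  nice-of-certificate : ∀ {x y} → NiceCertificate x y → NiceDT G R x y
  nice-of-certificate {x} {y} (gxy , ry , x≢y , (z , z≢x , c , isParentMap , py≡z) , y↛x) =
    record { other = z , z≢x , zy-face ; ext = extend }
    where
      zy-face : FaceDT G R ⟦ z ⇒ y ⟧
      zy-face with parentMap-face isParentMap
      ... | T , forest , roots , ⊆T =
        T , forest , roots , ⟦⇒⟧-⊆ (⊆T _ _ (ForestOf.forestOf⁺ R (lookup c) {z} ry (sym py≡z)))

      extend : ∀ F → FaceDT G R F → IsRoot F y →
               DirectedForest G (F ∪ ⟦ x ⇒ y ⟧) × FaceDT G R (F ∪ ⟦ x ⇒ y ⟧)
      extend F (F′ , forest , roots , F⊆F′) y-root =
        DirectedForest-⊆ F⁺⊆ forest″ , (_ , forest″ , roots″ , F⁺⊆)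
        where
          F′-y↛x : ¬ Path F′ y x
          F′-y↛x q with encode forest roots
          ... | c′ , isParentMap′ , F′⊆ = y↛x (c′ , isParentMap′ , Path-mono F′⊆ q)

          forest″ = redirect-forest forest gxy x≢y F′-y↛x
          roots″  = redirect-roots roots ry
          F⁺⊆     = ∪-⊆ (redirect-⊇ F⊆F′ y-root) (⟦⇒⟧-⊆ (redirect-new {F = F′} {x} {y}))

  module _ (uncertified : ∀ x y → ¬ NiceCertificate x y) where

    parentMap-unique : ∀ {p₁} → IsParentMap p₁ → ∀ c → IsParentMap (lookup c) →
                       ∀ v → R v ≡ false → lookup c v ≡ p₁ v
    parentMap-unique {p₁} isParentMap₁ c isParentMap v =
      forced-below n v (proj₂ (isParentMap₁ v)) c isParentMap
      where
        open ForestOf R p₁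

        Forced : Fin n → Set
        Forced v = ∀ c → IsParentMap (lookup c) → R v ≡ false → lookup c v ≡ p₁ v

        forced-below : ∀ k v → reachesRoot k v ≡ true → Forced v
        forced-below zero    v root _ _ rv = contradiction root (Bool.not-¬ rv)
        forced-below (suc k) v reach c isParentMap rv with lookup c v ≟ p₁ v | reachable? v (p₁ v)
        ... | yes agree   | _      = agree
        ... | no disagree | no v↛x = ⊥-elim (uncertified (p₁ v) v
              (proj₁ (isParentMap₁ v) rv , rv , x≢v ,
               (lookup c v , disagree , c , isParentMap , refl) , v↛x))
          where
            x≢v : p₁ v ≢ v
            x≢v eq = parentMap-acyclic isParentMap₁ (step (forestOf⁺ rv (sym eq)))
        ... | no _ | yes (c′ , isParentMap′ , v⇝x) =
          ⊥-elim (parentMap-acyclic isParentMap₁ (Path-trans (follow v⇝x (reachesRoot-parent k reach rv))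
                                                             (step (forestOf⁺ rv refl))))
          where
            transfer : ∀ {a b} → forestOf R (lookup c′) a b ≡ true → reachesRoot k b ≡ true →
                       forestOf R p₁ a b ≡ true
            transfer {a} {b} e reach-b with ForestOf.forestOf⁻ R (lookup c′) {a} e
            ... | rb , a≡ = forestOf⁺ rb (trans a≡ (forced-below k b reach-b c′ isParentMap′ rb))

            follow : ∀ {a b} → Path (forestOf R (lookup c′)) a b → reachesRoot k b ≡ true →
                     Path (forestOf R p₁) a b
            follow {a} (step e)   reach-b = step (transfer {a} e reach-b)
            follow {a} (cons e q) reach-b = cons (transfer {a} e (reachesRoot-path k q₁ reach-b)) q₁
              where q₁ = follow q reach-b

    ¬moreThanOneMaximal : ¬ MoreThanOneMaximal G R
    ¬moreThanOneMaximal (σ , τ , maximalσ , maximalτ , u , v , σ≢τ)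
      with maximalFace-encode maximalσ | maximalFace-encode maximalτ
    ... | c₁ , isParentMap₁ , σ≐ | c₂ , isParentMap₂ , τ≐ = σ≢τ (begin
      σ u v                      ≡⟨ σ≐ u v ⟩
      forestOf R (lookup c₁) u v ≡⟨ forestOf-cong (parentMap-unique isParentMap₁ c₂ isParentMap₂) u v ⟩
      forestOf R (lookup c₂) u v ≡⟨ τ≐ u v ⟨
      τ u v                      ∎)
      where open ≡-Reasoning

lemma2p6 : (n : ℕ) (G : Digraph n) (R : VSet n) → (∃ λ v → R v ≡ true) →
    MoreThanOneMaximal G R →
    Σ (Fin n) λ x → Σ (Fin n) λ y → G x y ≡ true × NiceDT G R x y
lemma2p6 n G R _ moreThanOne with any? (λ x → any? (niceCertificate? G R x))
... | yes (x , y , certificate) = x , y , proj₁ certificate , nice-of-certificate G R certificate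
... | no none = ⊥-elim (¬moreThanOneMaximal G R (λ x y → none ∘ (x ,_) ∘ (y ,_)) moreThanOne)
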